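{- Let $G_0=(V_0,E_0)$ be a finite bipartite graph, let $\mathcal{S}$ be a finite set of scenarios, and for each $S\in\mathcal{S}$ let $G_S=(V_S,E_S)$ be a finite bipartite graph, with probabilities $p_S\ge 0$ and weights $\lambda_v\ge 0$. Assume there is a partition $(V_1,V_2)$ of $V_0\cup\bigcup_{S\in\mathcal{S}}V_S$ such that every edge of $E_0$ and of every $E_S$ has one endpoint in $V_1$ and one in $V_2$. Consider the linear program with variables $y\in\mathbb{R}^{V_0}$, $y^S\in\mathbb{R}^{V_S}$, $\delta^S,d^S\in\mathbb{R}^{V_0\cap V_S}$ ($S\in\mathcal{S}$): $$\min \sum_{S\in\mathcal{S}}p_S\sum_{v\in V_0\cap V_S}\lambda_v(\delta^S_v+d^S_v)$$ subject to $y_u+y_v\ge 1$ for all $uv\in E_0$; $\sum_{v\in V_0}y_v=\nu(G_0)$; $y\ge 0$; $y^S_u+y^S_v\ge 1$ for all $uv\in E_S$, $S\in\mathcal{S}$; $\sum_{v\in V_S}y^S_v=\nu(G_S)$ for all $S\in\mathcal{S}$; $y^S\ge 0$; $y_v-y^S_v\le \delta^S_v$ and $y^S_v-y_v\le d^S_v$ for all $v\in V_0\cap V_S$, $S\in\mathcal{S}$; $\delta^S\ge 0$, $d^S\ge 0$. Then the feasible region of this linear program is an integral polyhedron.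
   Context: For a graph $G$, $\nu(G)$ denotes the maximum cardinality of a matching in $G$. A polyhedron is integral if each of its nonempty faces contains an integer point (for a pointed polyhedron, equivalently, all its vertices are integral). The constraints on $y$ (resp. $y^S$) say that $y$ lies in the core of the assignment game on $G_0$ (resp. $G_S$), i.e. is a minimum fractional vertex cover.
   Formalization: The variables y, $y^S$, $\delta^S$, $d^S$ take values in ℚ rather than ℝ, faces are cut out by valid inequalities with rational coefficients, and the probabilities $p_S$ and weights $\lambda_v$ are rational. -}

module Defs where

open import Data.Nat using (ℕ; zero; suc) renaming (_≤_ to _≤ℕ_)
open import Data.Integer using (ℤ; +_)
open import Data.Rational using (ℚ; _/_; 0ℚ; 1ℚ; _+_; _-_; _*_; _≤_)
open import Relation.Nullary using (¬_)
open import Data.Fin using (Fin; zero; suc)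
open import Data.Bool using (Bool; true; false; T; if_then_else_; _∧_)
open import Data.List using (List; length)
open import Data.List.Membership.Propositional using (_∈_)
open import Data.List.Relation.Unary.All using (All)
open import Data.List.Relation.Unary.AllPairs using (AllPairs)
open import Data.Product using (_×_; _,_; Σ; ∃)
open import Relation.Binary.PropositionalEquality using (_≡_; _≢_)

Σℚ : (n : ℕ) → (Fin n → ℚ) → ℚ
Σℚ zero    f = 0ℚ
Σℚ (suc n) f = f zero + Σℚ n (λ i → f (suc i))

ℕ→ℚ : ℕ → ℚ
ℕ→ℚ k = (+ k) / 1

ℤ→ℚ : ℤ → ℚ
ℤ→ℚ k = k / 1

IsInteger : ℚ → Set
IsInteger q = ∃ λ (k : ℤ) → q ≡ ℤ→ℚ k

-- Graphs. All vertices live in a common universe Fin n. A graph is given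
-- by a vertex set (a Boolean predicate on Fin n) and an edge list; an edge
-- (u , v) is the unordered edge uv.

Edge : ℕ → Set
Edge n = Fin n × Fin n

DisjointEdges : ∀ {n} → Edge n → Edge n → Set
DisjointEdges (a , b) (c , d) = (a ≢ c) × (a ≢ d) × (b ≢ c) × (b ≢ d)

IsMatching : ∀ {n} → List (Edge n) → List (Edge n) → Set
IsMatching E M = All (λ e → e ∈ E) M × AllPairs DisjointEdges M

IsMatchingNumber : ∀ {n} → List (Edge n) → ℕ → Set
IsMatchingNumber E k =
  (∃ λ M → IsMatching E M × length M ≡ k) ×
  (∀ M → IsMatching E M → length M ≤ℕ k)

-- The coordinates of the LP. Coordinates are indexed by the whole universe
-- Fin n; coordinates outside the respective index set (V0, V_S, V0 ∩ V_S)
-- are fixed to 0 by the constraints below.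

record Point (n m : ℕ) : Set where
  constructor pt
  field
    y  : Fin n → ℚ
    yS : Fin m → Fin n → ℚ
    δ  : Fin m → Fin n → ℚ
    d  : Fin m → Fin n → ℚ
open Point public

dot : ∀ {n m} → Point n m → Point n m → ℚ
dot {n} {m} c x =
  Σℚ n (λ v → y c v * y x v) +
  Σℚ m (λ S → Σℚ n (λ v →
     (yS c S v * yS x S v + δ c S v * δ x S v) + d c S v * d x S v))

IsIntegerPoint : ∀ {n m} → Point n m → Set
IsIntegerPoint {n} {m} x =
  (∀ v → IsInteger (y x v)) ×
  (∀ S v → IsInteger (yS x S v)) ×
  (∀ S v → IsInteger (δ x S v)) ×
  (∀ S v → IsInteger (d x S v))

-- Integral polyhedron: every nonempty face {x ∈ P | c·x = β}, where c·x ≤ β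
-- is valid for P, contains an integer point (c = 0, β = 0 gives P itself).
IsIntegralPolyhedron : ∀ {n m} → (Point n m → Set) → Set
IsIntegralPolyhedron {n} {m} P =
  ∀ (c : Point n m) (β : ℚ) →
  (∀ x → P x → dot c x ≤ β) →
  (∃ λ x → P x × dot c x ≡ β) →
  ∃ λ z → P z × IsIntegerPoint z × dot c z ≡ β

record Feasible {n m : ℕ}
    (V₀ : Fin n → Bool) (E₀ : List (Edge n)) (ν₀ : ℕ)
    (V : Fin m → Fin n → Bool) (E : Fin m → List (Edge n)) (ν : Fin m → ℕ)
    (x : Point n m) : Set where
  field
    y-edge  : ∀ {u v} → (u , v) ∈ E₀ → 1ℚ ≤ y x u + y x v
    y-sum   : Σℚ n (λ v → if V₀ v then y x v else 0ℚ) ≡ ℕ→ℚ ν₀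
    y-nonneg : ∀ v → T (V₀ v) → 0ℚ ≤ y x v
    yS-edge : ∀ S {u v} → (u , v) ∈ E S → 1ℚ ≤ yS x S u + yS x S v
    yS-sum  : ∀ S → Σℚ n (λ v → if V S v then yS x S v else 0ℚ) ≡ ℕ→ℚ (ν S)
    yS-nonneg : ∀ S v → T (V S v) → 0ℚ ≤ yS x S v
    δ-bound : ∀ S v → T (V₀ v ∧ V S v) → y x v + (0ℚ - yS x S v) ≤ δ x S v
    d-bound : ∀ S v → T (V₀ v ∧ V S v) → yS x S v + (0ℚ - y x v) ≤ d x S v
    δ-nonneg : ∀ S v → T (V₀ v ∧ V S v) → 0ℚ ≤ δ x S v
    d-nonneg : ∀ S v → T (V₀ v ∧ V S v) → 0ℚ ≤ d x S v
    y-out  : ∀ v → ¬ T (V₀ v) → y x v ≡ 0ℚ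
    yS-out : ∀ S v → ¬ T (V S v) → yS x S v ≡ 0ℚ
    δ-out  : ∀ S v → ¬ T (V₀ v ∧ V S v) → δ x S v ≡ 0ℚ
    d-out  : ∀ S v → ¬ T (V₀ v ∧ V S v) → d x S v ≡ 0ℚ

-- Round every y- and y^S-coordinate to 0 or 1 with a threshold depending on
-- the side of the bipartition: on one side a value rounds up as soon as it is positive, on the
-- other only once it reaches 1; round the deviations to the positive parts of the differences of
-- the rounded values. An edge covered by x stays covered by the rounded point z, and also by
-- x + t (x - z) for every small t > 0. Both points then cover a maximum matching, so their
-- sums are at least ν; as x lies strictly between them and its sums equal ν, both are
-- feasible. Hence every face through x contains the integer point z.

module Submission where

open import Defs
open import Data.Nat using (ℕ; zero; suc)
open import Data.Integer using (+_)
import Data.Integer.Solver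
open import Data.Rational using (ℚ; 0ℚ; 1ℚ; toℚᵘ; _+_; _-_; _*_; _≤_; _<_; _⊓_; -_; nonNegative; positive)
open import Data.Rational.Properties
  using (module ≤-Reasoning; _<?_; _≤?_; ≤-refl; ≤-reflexive; ≤-trans; ≤-antisym; <⇒≤; ≮⇒≥; ≰⇒>;
         <-irrefl; <-≤-trans; +-assoc; +-comm; +-identityʳ; +-inverseʳ; +-mono-≤; +-mono-≤-<; +-monoʳ-≤;
         +-monoˡ-≤; +-monoˡ-<; *-zeroʳ; *-monoˡ-≤-nonNeg; *-cancelˡ-≤-pos; p⊓q≤p; p⊓q≤q; ⊓-sel;
         toℚᵘ-injective; toℚᵘ-fromℚᵘ; toℚᵘ-homo-+)
open import Data.Rational.Solver using (module +-*-Solver)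
import Data.Rational.Unnormalised as ℚᵘ
open import Data.Rational.Unnormalised using (mkℚᵘ; *≡*)
open import Data.Rational.Unnormalised.Properties using (≃-sym; +-congʳ; module ≃-Reasoning)
open import Data.Bool using (Bool; true; false; T; not; _∧_; if_then_else_)
open import Data.Fin using (Fin; zero; suc)
import Data.Fin.Properties as Fin
open import Data.Vec.Functional using (updateAt)
open import Data.Vec.Functional.Properties using (updateAt-updates; updateAt-minimal)
open import Data.List using (List; []; _∷_; length)
open import Data.List.Membership.Propositional using (_∈_)
open import Data.List.Relation.Unary.All as All using (All; []; _∷_)
open import Data.List.Relation.Unary.AllPairs using (AllPairs; []; _∷_)
open import Data.Product using (_×_; _,_; ∃; proj₁; proj₂)
open import Data.Sum using (inj₁; inj₂)
open import Data.Unit using (tt)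
open import Data.Empty using (⊥-elim)
open import Relation.Nullary using (¬_; Dec; yes; no; does)
open import Relation.Nullary.Decidable using (True; toWitness)
open import Relation.Binary.PropositionalEquality
  using (module ≡-Reasoning; _≡_; _≢_; refl; sym; trans; cong; cong₂; subst)
open import Function using (_∘_; const)

open +-*-Solver

0<1 : 0ℚ < 1ℚ
0<1 = toWitness {a? = 0ℚ <? 1ℚ} tt

≤-by-decision : ∀ {p q} → True (p ≤? q) → p ≤ q
≤-by-decision {p} {q} = toWitness {a? = p ≤? q}

0≤1 : 0ℚ ≤ 1ℚ
0≤1 = <⇒≤ 0<1

+-nonNeg : ∀ {p q} → 0ℚ ≤ p → 0ℚ ≤ q → 0ℚ ≤ p + q
+-nonNeg = +-mono-≤

*-nonNeg : ∀ {p q} → 0ℚ ≤ p → 0ℚ ≤ q → 0ℚ ≤ p * q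
*-nonNeg {p} {q} 0≤p 0≤q = subst (_≤ p * q) (*-zeroʳ p) (*-monoˡ-≤-nonNeg p {{nonNegative 0≤p}} 0≤q)

*-cancelˡ-nonNeg : ∀ {t p} → 0ℚ < t → 0ℚ ≤ t * p → 0ℚ ≤ p
*-cancelˡ-nonNeg {t} {p} 0<t 0≤tp = *-cancelˡ-≤-pos t {{positive 0<t}} (subst (_≤ t * p) (sym (*-zeroʳ t)) 0≤tp)

p≤q⇒0≤q-p : ∀ {p q} → p ≤ q → 0ℚ ≤ q - p
p≤q⇒0≤q-p {p} {q} p≤q = subst (_≤ q - p) (+-inverseʳ p) (+-monoˡ-≤ (- p) p≤q)

≤-by-slack : ∀ {p q} s → q ≡ p + s → 0ℚ ≤ s → p ≤ q
≤-by-slack {p} s refl 0≤s = subst (_≤ p + s) (+-identityʳ p) (+-monoʳ-≤ p 0≤s)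

0≤q-p⇒p≤q : ∀ {p q} → 0ℚ ≤ q - p → p ≤ q
0≤q-p⇒p≤q {p} {q} = ≤-by-slack (q - p) (solve 2 (λ p q → q := p :+ (q :- p)) refl p q)

minimum : ∀ k → (Fin k → ℚ) → ℚ
minimum zero    f = 1ℚ
minimum (suc k) f = f zero ⊓ minimum k (f ∘ suc)

minimum-≤ : ∀ k (f : Fin k → ℚ) i → minimum k f ≤ f i
minimum-≤ (suc k) f zero    = p⊓q≤p (f zero) (minimum k (f ∘ suc))
minimum-≤ (suc k) f (suc i) = ≤-trans (p⊓q≤q (f zero) (minimum k (f ∘ suc))) (minimum-≤ k (f ∘ suc) i)

minimum-pos : ∀ k (f : Fin k → ℚ) → (∀ i → 0ℚ < f i) → 0ℚ < minimum k f
minimum-pos zero    f 0<f = 0<1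
minimum-pos (suc k) f 0<f with ⊓-sel (f zero) (minimum k (f ∘ suc))
... | inj₁ ⊓≡f₀   = subst (0ℚ <_) (sym ⊓≡f₀) (0<f zero)
... | inj₂ ⊓≡rest = subst (0ℚ <_) (sym ⊓≡rest) (minimum-pos k (f ∘ suc) (0<f ∘ suc))

-- Extrapolation

extrapolate : ℚ → ℚ → ℚ → ℚ
extrapolate t z a = a + t * (a - z)

extrapolate-self : ∀ t a → extrapolate t a a ≡ a
extrapolate-self = solve 2 (λ t a → a :+ t :* (a :- a) := a) refl

extrapolate-+ : ∀ t z a z′ a′ →
  extrapolate t z a + extrapolate t z′ a′ ≡ extrapolate t (z + z′) (a + a′)
extrapolate-+ = solve 5 (λ t z a z′ a′ →
  (a :+ t :* (a :- z)) :+ (a′ :+ t :* (a′ :- z′)) := (a :+ a′) :+ t :* ((a :+ a′) :- (z :+ z′))) refl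

extrapolate-difference : ∀ t z a z′ a′ →
  extrapolate t z a + (0ℚ - extrapolate t z′ a′) ≡ extrapolate t (z + (0ℚ - z′)) (a + (0ℚ - a′))
extrapolate-difference = solve 5 (λ t z a z′ a′ →
  (a :+ t :* (a :- z)) :+ (con 0ℚ :- (a′ :+ t :* (a′ :- z′)))
    := (a :+ (con 0ℚ :- a′)) :+ t :* ((a :+ (con 0ℚ :- a′)) :- (z :+ (con 0ℚ :- z′)))) refl

*-extrapolate : ∀ t c z a → c * extrapolate t z a ≡ extrapolate t (c * z) (c * a)
*-extrapolate = solve 4 (λ t c z a → c :* (a :+ t :* (a :- z)) := c :* a :+ t :* (c :* a :- c :* z)) refl

≤-extrapolate : ∀ {t z a} → 0ℚ ≤ t → z ≤ a → a ≤ extrapolate t z a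
≤-extrapolate {t} {z} {a} 0≤t z≤a = ≤-by-slack (t * (a - z)) refl (*-nonNeg 0≤t (p≤q⇒0≤q-p z≤a))

extrapolate-nonNeg : ∀ {t z a} → 0ℚ ≤ t → t ≤ a → z ≤ 1ℚ → 0ℚ ≤ extrapolate t z a
extrapolate-nonNeg {t} {z} {a} 0≤t t≤a z≤1 =
  ≤-by-slack ((a - t) + t * (1ℚ - z) + t * a)
    (solve 3 (λ t z a → a :+ t :* (a :- z) := con 0ℚ :+ ((a :- t) :+ t :* (con 1ℚ :- z) :+ t :* a)) refl t z a)
    (+-nonNeg (+-nonNeg (p≤q⇒0≤q-p t≤a) (*-nonNeg 0≤t (p≤q⇒0≤q-p z≤1))) (*-nonNeg 0≤t (≤-trans 0≤t t≤a)))

extrapolate-mono : ∀ t z a z′ a′ → 0ℚ ≤ extrapolate t (z′ - z) (a′ - a) →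
  extrapolate t z a ≤ extrapolate t z′ a′
extrapolate-mono t z a z′ a′ =
  ≤-by-slack _ (solve 5 (λ t z a z′ a′ →
    a′ :+ t :* (a′ :- z′) := (a :+ t :* (a :- z)) :+ ((a′ :- a) :+ t :* ((a′ :- a) :- (z′ :- z)))) refl t z a z′ a′)

extrapolate≤⇒≤ : ∀ {t z a} → 0ℚ < t → extrapolate t z a ≤ a → a ≤ z
extrapolate≤⇒≤ {t} {z} {a} 0<t ext≤a = 0≤q-p⇒p≤q (*-cancelˡ-nonNeg 0<t
  (subst (0ℚ ≤_) (solve 3 (λ t z a → a :- (a :+ t :* (a :- z)) := t :* (z :- a)) refl t z a) (p≤q⇒0≤q-p ext≤a)))

≤extrapolate⇒≤ : ∀ {t z a} → 0ℚ < t → a ≤ extrapolate t z a → z ≤ a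
≤extrapolate⇒≤ {t} {z} {a} 0<t a≤ext = 0≤q-p⇒p≤q (*-cancelˡ-nonNeg 0<t
  (subst (0ℚ ≤_) (solve 3 (λ t z a → (a :+ t :* (a :- z)) :- a := t :* (a :- z)) refl t z a) (p≤q⇒0≤q-p a≤ext)))

Σℚ-cong : ∀ n {f g : Fin n → ℚ} → (∀ i → f i ≡ g i) → Σℚ n f ≡ Σℚ n g
Σℚ-cong zero    f≗g = refl
Σℚ-cong (suc n) f≗g = cong₂ _+_ (f≗g zero) (Σℚ-cong n (f≗g ∘ suc))

Σℚ-nonNeg : ∀ n {f : Fin n → ℚ} → (∀ i → 0ℚ ≤ f i) → 0ℚ ≤ Σℚ n f
Σℚ-nonNeg zero    0≤f = ≤-refl
Σℚ-nonNeg (suc n) 0≤f = +-nonNeg (0≤f zero) (Σℚ-nonNeg n (0≤f ∘ suc))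

Σℚ-extrapolate : ∀ t n (z a : Fin n → ℚ) {f : Fin n → ℚ} → (∀ i → f i ≡ extrapolate t (z i) (a i)) →
  Σℚ n f ≡ extrapolate t (Σℚ n z) (Σℚ n a)
Σℚ-extrapolate t zero    z a f≗ = sym (extrapolate-self t 0ℚ)
Σℚ-extrapolate t (suc n) z a f≗ =
  trans (cong₂ _+_ (f≗ zero) (Σℚ-extrapolate t n (z ∘ suc) (a ∘ suc) (f≗ ∘ suc)))
        (extrapolate-+ t (z zero) (a zero) (Σℚ n (z ∘ suc)) (Σℚ n (a ∘ suc)))

Σℚ-zeroAt : ∀ n (h : Fin n → ℚ) i → Σℚ n h ≡ h i + Σℚ n (updateAt h i (const 0ℚ))
Σℚ-zeroAt (suc n) h zero    = solve 2 (λ a s → a :+ s := a :+ (con 0ℚ :+ s)) refl (h zero) (Σℚ n (h ∘ suc))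
Σℚ-zeroAt (suc n) h (suc i) =
  trans (cong (_+_ (h zero)) (Σℚ-zeroAt n (h ∘ suc) i))
        (solve 3 (λ a b s → a :+ (b :+ s) := b :+ (a :+ s)) refl
               (h zero) (h (suc i)) (Σℚ n (updateAt (h ∘ suc) i (const 0ℚ))))

Σℚ-restrict : ∀ n (W : Fin n → Bool) {f : Fin n → ℚ} → (∀ v → ¬ T (W v) → f v ≡ 0ℚ) →
  Σℚ n (λ v → if W v then f v else 0ℚ) ≡ Σℚ n f
Σℚ-restrict n W {f} f-out = Σℚ-cong n (λ v → restrict (W v) (f-out v))
  where
  restrict : ∀ b {q} → (¬ T b → q ≡ 0ℚ) → (if b then q else 0ℚ) ≡ q
  restrict true  _     = refl
  restrict false q-out = sym (q-out (λ ()))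

extrapolatePoint : ∀ {n m} → ℚ → Point n m → Point n m → Point n m
extrapolatePoint t z x = pt (λ v → extrapolate t (y z v) (y x v)) (λ S v → extrapolate t (yS z S v) (yS x S v))
                            (λ S v → extrapolate t (δ z S v) (δ x S v)) (λ S v → extrapolate t (d z S v) (d x S v))

dot-extrapolate : ∀ {n m} t (c z x : Point n m) →
  dot c (extrapolatePoint t z x) ≡ extrapolate t (dot c z) (dot c x)
dot-extrapolate {n} {m} t c z x =
  trans (cong₂ _+_ (Σℚ-extrapolate t n (stage₁ z) (stage₁ x) (λ v → *-extrapolate t (y c v) (y z v) (y x v)))
                   (Σℚ-extrapolate t m (λ S → Σℚ n (stage₂ z S)) (λ S → Σℚ n (stage₂ x S))
                      (λ S → Σℚ-extrapolate t n (stage₂ z S) (stage₂ x S) (stage₂-extrapolate S))))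
        (extrapolate-+ t (Σℚ n (stage₁ z)) (Σℚ n (stage₁ x))
                         (Σℚ m (λ S → Σℚ n (stage₂ z S))) (Σℚ m (λ S → Σℚ n (stage₂ x S))))
  where
  stage₁ : Point n m → Fin n → ℚ
  stage₁ p v = y c v * y p v
  stage₂ : Point n m → Fin m → Fin n → ℚ
  stage₂ p S v = (yS c S v * yS p S v + δ c S v * δ p S v) + d c S v * d p S v
  stage₂-extrapolate : ∀ S v → stage₂ (extrapolatePoint t z x) S v ≡ extrapolate t (stage₂ z S v) (stage₂ x S v)
  stage₂-extrapolate S v = begin
    stage₂ (extrapolatePoint t z x) S v
      ≡⟨ cong₂ _+_ (cong₂ _+_ (*-extrapolate t (yS c S v) (yS z S v) (yS x S v))
                              (*-extrapolate t (δ c S v) (δ z S v) (δ x S v)))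
                   (*-extrapolate t (d c S v) (d z S v) (d x S v)) ⟩
    (extrapolate t Yz Yx + extrapolate t Δz Δx) + extrapolate t Dz Dx
      ≡⟨ cong (λ s → s + extrapolate t Dz Dx) (extrapolate-+ t Yz Yx Δz Δx) ⟩
    extrapolate t (Yz + Δz) (Yx + Δx) + extrapolate t Dz Dx
      ≡⟨ extrapolate-+ t (Yz + Δz) (Yx + Δx) Dz Dx ⟩
    extrapolate t (stage₂ z S v) (stage₂ x S v) ∎
    where
    open ≡-Reasoning
    Yz Yx Δz Δx Dz Dx : ℚ
    Yz = yS c S v * yS z S v
    Yx = yS c S v * yS x S v
    Δz = δ c S v * δ z S v
    Δx = δ c S v * δ x S v
    Dz = d c S v * d z S v
    Dx = d c S v * d x S v

-- x lies strictly between z and the extrapolated point, so every face of P through x contains z.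
integral-by-extrapolation : ∀ {n m} {P : Point n m → Set} →
  (∀ x → P x → ∃ λ z → P z × IsIntegerPoint z × ∃ λ t → 0ℚ < t × P (extrapolatePoint t z x)) →
  IsIntegralPolyhedron P
integral-by-extrapolation toward-integer c β valid (x , Px , cx≡β) with toward-integer x Px
... | z , Pz , z-integer , t , 0<t , P-extrapolated =
  z , Pz , z-integer , ≤-antisym (valid z Pz) (extrapolate≤⇒≤ 0<t extrapolated≤β)
  where
  extrapolated≤β : extrapolate t (dot c z) β ≤ β
  extrapolated≤β = subst (λ e → extrapolate t (dot c z) e ≤ β) cx≡β
                     (subst (_≤ β) (dot-extrapolate t c z x) (valid _ P-extrapolated))

-- Matchings and fractional vertex covers

ℕ→ℚ-suc : ∀ k → ℕ→ℚ (suc k) ≡ 1ℚ + ℕ→ℚ k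
ℕ→ℚ-suc k = toℚᵘ-injective (begin
  toℚᵘ (ℕ→ℚ (suc k))         ≈⟨ toℚᵘ-fromℚᵘ (mkℚᵘ (+ suc k) 0) ⟩
  mkℚᵘ (+ suc k) 0           ≈⟨ *≡* (ℤ.solve 1 (λ K → (ℤ.con (+ 1) ℤ.:+ K) ℤ.:* ℤ.con (+ 1)
                                 ℤ.:= (ℤ.con (+ 1) ℤ.:+ K ℤ.:* ℤ.con (+ 1)) ℤ.:* ℤ.con (+ 1)) refl (+ k)) ⟩
  toℚᵘ 1ℚ ℚᵘ.+ mkℚᵘ (+ k) 0  ≈⟨ +-congʳ (toℚᵘ 1ℚ) (≃-sym (toℚᵘ-fromℚᵘ (mkℚᵘ (+ k) 0))) ⟩
  toℚᵘ 1ℚ ℚᵘ.+ toℚᵘ (ℕ→ℚ k)  ≈⟨ ≃-sym (toℚᵘ-homo-+ 1ℚ (ℕ→ℚ k)) ⟩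
  toℚᵘ (1ℚ + ℕ→ℚ k)          ∎)
  where
  open ≃-Reasoning
  module ℤ = Data.Integer.Solver.+-*-Solver

NonLoop : ∀ {n} → Edge n → Set
NonLoop (a , b) = a ≢ b

IsCoveredBy : ∀ {n} → (Fin n → ℚ) → Edge n → Set
IsCoveredBy h (a , b) = 1ℚ ≤ h a + h b

zeroAt-nonNeg : ∀ {n} {h : Fin n → ℚ} → (∀ v → 0ℚ ≤ h v) → ∀ i v → 0ℚ ≤ updateAt h i (const 0ℚ) v
zeroAt-nonNeg {h = h} 0≤h i v with v Fin.≟ i
... | yes refl = subst (0ℚ ≤_) (sym (updateAt-updates i h)) ≤-refl
... | no v≢i   = subst (0ℚ ≤_) (sym (updateAt-minimal v i h v≢i)) (0≤h v)

matching≤cover : ∀ {n} (h : Fin n → ℚ) → (∀ v → 0ℚ ≤ h v) → (M : List (Edge n)) → AllPairs DisjointEdges M →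
  All (λ e → NonLoop e × IsCoveredBy h e) M → ℕ→ℚ (length M) ≤ Σℚ n h
matching≤cover {n} h 0≤h []            []                   []                   = Σℚ-nonNeg n 0≤h
matching≤cover {n} h 0≤h ((u , v) ∷ M) (disjoint ∷ pairwise) ((u≢v , uv-covered) ∷ M-covered) = begin
  ℕ→ℚ (suc (length M))      ≡⟨ ℕ→ℚ-suc (length M) ⟩
  1ℚ + ℕ→ℚ (length M)       ≤⟨ +-mono-≤ uv-covered (matching≤cover h″ 0≤h″ M pairwise M-covered″) ⟩
  (h u + h v) + Σℚ n h″     ≡⟨ +-assoc (h u) (h v) (Σℚ n h″) ⟩
  h u + (h v + Σℚ n h″)     ≡⟨ cong (λ x → h u + (x + Σℚ n h″)) (sym (updateAt-minimal v u h (u≢v ∘ sym))) ⟩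
  h u + (h′ v + Σℚ n h″)    ≡⟨ cong (_+_ (h u)) (sym (Σℚ-zeroAt n h′ v)) ⟩
  h u + Σℚ n h′             ≡⟨ sym (Σℚ-zeroAt n h u) ⟩
  Σℚ n h                    ∎
  where
  open ≤-Reasoning
  h′ h″ : Fin n → ℚ
  h′ = updateAt h u (const 0ℚ)
  h″ = updateAt h′ v (const 0ℚ)
  0≤h″ : ∀ i → 0ℚ ≤ h″ i
  0≤h″ = zeroAt-nonNeg (zeroAt-nonNeg 0≤h u) v
  still-covered : ∀ {e} → DisjointEdges (u , v) e × NonLoop e × IsCoveredBy h e → NonLoop e × IsCoveredBy h″ e
  still-covered {a , b} ((u≢a , u≢b , v≢a , v≢b) , a≢b , ab-covered) =
    a≢b , subst (1ℚ ≤_) (sym (cong₂ _+_ (unchanged u≢a v≢a) (unchanged u≢b v≢b))) ab-covered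
    where
    unchanged : ∀ {x} → u ≢ x → v ≢ x → h″ x ≡ h x
    unchanged {x} u≢x v≢x = trans (updateAt-minimal x v h′ (v≢x ∘ sym)) (updateAt-minimal x u h (u≢x ∘ sym))
  M-covered″ : All (λ e → NonLoop e × IsCoveredBy h″ e) M
  M-covered″ = All.zipWith still-covered (disjoint , M-covered)

matchingNumber≤cover : ∀ {n} {E : List (Edge n)} {k} (h : Fin n → ℚ) → IsMatchingNumber E k →
  (∀ {a b} → (a , b) ∈ E → a ≢ b) → (∀ v → 0ℚ ≤ h v) → (∀ {a b} → (a , b) ∈ E → 1ℚ ≤ h a + h b) →
  ℕ→ℚ k ≤ Σℚ n h
matchingNumber≤cover {E = E} h ((M , (M⊆E , pairwise) , refl) , _) loopless 0≤h covers =
  matching≤cover h 0≤h M pairwise (All.map edge-facts M⊆E)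
  where
  edge-facts : ∀ {e} → e ∈ E → NonLoop e × IsCoveredBy h e
  edge-facts {a , b} e∈E = loopless e∈E , covers e∈E

-- Threshold rounding

Bool→ℚ : Bool → ℚ
Bool→ℚ true  = 1ℚ
Bool→ℚ false = 0ℚ

Bool→ℚ-nonNeg : ∀ b → 0ℚ ≤ Bool→ℚ b
Bool→ℚ-nonNeg true  = 0≤1
Bool→ℚ-nonNeg false = ≤-refl

Bool→ℚ-integer : ∀ b → IsInteger (Bool→ℚ b)
Bool→ℚ-integer true  = + 1 , refl
Bool→ℚ-integer false = + 0 , refl

Bool→ℚ-∧-T : ∀ {b} r → T b → Bool→ℚ (b ∧ r) ≡ Bool→ℚ r
Bool→ℚ-∧-T {true} r _ = refl

Bool→ℚ-∧-¬T : ∀ {b} r → ¬ T b → Bool→ℚ (b ∧ r) ≡ 0ℚ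
Bool→ℚ-∧-¬T {true}  r b-false = ⊥-elim (b-false tt)
Bool→ℚ-∧-¬T {false} r _       = refl

Bool→ℚ-deviation : ∀ r s → Bool→ℚ r + (0ℚ - Bool→ℚ s) ≤ Bool→ℚ (r ∧ not s)
Bool→ℚ-deviation true  true  = ≤-refl
Bool→ℚ-deviation true  false = ≤-refl
Bool→ℚ-deviation false true  = ≤-by-decision tt
Bool→ℚ-deviation false false = ≤-refl

Bool→ℚ-deviation-slack : ∀ r s → Bool→ℚ (r ∧ not s) - (Bool→ℚ r + (0ℚ - Bool→ℚ s)) ≡ Bool→ℚ (not r ∧ s)
Bool→ℚ-deviation-slack true  true  = refl
Bool→ℚ-deviation-slack true  false = refl
Bool→ℚ-deviation-slack false true  = refl
Bool→ℚ-deviation-slack false false = refl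

-- Opaque, so that the decisions stay unreduced and `with` can abstract over them.
opaque
  0<? : (q : ℚ) → Dec (0ℚ < q)
  0<? q = 0ℚ <? q

  1≤? : (q : ℚ) → Dec (1ℚ ≤ q)
  1≤? q = 1ℚ ≤? q

roundsUp : Bool → ℚ → Bool
roundsUp true  q = does (0<? q)
roundsUp false q = does (1≤? q)

margin : Bool → ℚ → ℚ
margin true  q = if does (0<? q) then q else 1ℚ
margin false q = if does (1≤? q) then 1ℚ else 1ℚ - q

round : Bool → ℚ → ℚ
round b q = Bool→ℚ (roundsUp b q)

push : ℚ → Bool → ℚ → ℚ
push t b q = extrapolate t (round b q) q

margin-pos : ∀ b q → 0ℚ < margin b q
margin-pos true  q with 0<? q
... | yes 0<q = 0<q
... | no _    = 0<1
margin-pos false q with 1≤? q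
... | yes _   = 0<1
... | no 1≰q  = subst (_< 1ℚ - q) (+-inverseʳ q) (+-monoˡ-< (- q) (≰⇒> 1≰q))

roundsUp-0 : ∀ b → roundsUp b 0ℚ ≡ false
roundsUp-0 true  with 0<? 0ℚ
... | yes 0<0 = ⊥-elim (<-irrefl refl 0<0)
... | no _    = refl
roundsUp-0 false with 1≤? 0ℚ
... | yes 1≤0 = ⊥-elim (<-irrefl refl (<-≤-trans 0<1 1≤0))
... | no _    = refl

roundsUp⇒margin≤ : ∀ b {q} → roundsUp b q ≡ true → margin b q ≤ q
roundsUp⇒margin≤ true  {q} up with 0<? q
... | yes _ = ≤-refl
roundsUp⇒margin≤ false {q} up with 1≤? q
... | yes 1≤q = 1≤q

push-nonNeg : ∀ {t} b {q} → 0ℚ ≤ t → 0ℚ ≤ q → t ≤ margin b q → 0ℚ ≤ push t b q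
push-nonNeg {t} b {q} 0≤t 0≤q t≤m with roundsUp b q in up
... | true  = extrapolate-nonNeg 0≤t (≤-trans t≤m (roundsUp⇒margin≤ b up)) ≤-refl
... | false = ≤-trans 0≤q (≤-extrapolate 0≤t 0≤q)

rounding-gap : ∀ b {t a c} → t ≤ margin b a → t ≤ margin b c →
  roundsUp b a ≡ false → roundsUp b c ≡ true → t ≤ c - a
rounding-gap true {t} {a} {c} _ t≤mc down up with 0<? a | 0<? c
... | no 0≮a | yes _ = ≤-trans t≤mc (≤-by-slack (0ℚ - a)
        (solve 2 (λ a c → c :- a := c :+ (con 0ℚ :- a)) refl a c) (p≤q⇒0≤q-p (≮⇒≥ 0≮a)))
rounding-gap false {t} {a} {c} t≤ma _ down up with 1≤? a | 1≤? c
... | no _ | yes 1≤c = ≤-trans t≤ma (≤-by-slack (c - 1ℚ)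
        (solve 2 (λ a c → c :- a := (con 1ℚ :- a) :+ (c :- con 1ℚ)) refl a c) (p≤q⇒0≤q-p 1≤c))

rounding-covers-edge : ∀ {t p q} → 0ℚ ≤ t → 0ℚ ≤ p → t ≤ margin true p → 1ℚ ≤ p + q →
  1ℚ ≤ round true p + round false q × 1ℚ ≤ push t true p + push t false q
rounding-covers-edge {t} {p} {q} 0≤t 0≤p t≤m 1≤p+q with 1≤? q
... | yes 1≤q = +-mono-≤ (Bool→ℚ-nonNeg (roundsUp true p)) ≤-refl
              , +-mono-≤ (push-nonNeg true 0≤t 0≤p t≤m) (≤-trans 1≤q (≤-extrapolate 0≤t 1≤q))
... | no 1≰q with 0<? p
...   | yes _   = ≤-refl
                , subst (1ℚ ≤_) (sym (extrapolate-+ t 1ℚ p 0ℚ q)) (≤-trans 1≤p+q (≤-extrapolate 0≤t 1≤p+q))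
...   | no 0≮p  = ⊥-elim (<-irrefl refl (<-≤-trans (+-mono-≤-< (≮⇒≥ 0≮p) (≰⇒> 1≰q)) 1≤p+q))

rounding-covers-bipartite-edge : ∀ {t} b b′ {p q} → b ≢ b′ → 0ℚ ≤ t → 0ℚ ≤ p → 0ℚ ≤ q →
  t ≤ margin b p → t ≤ margin b′ q → 1ℚ ≤ p + q →
  1ℚ ≤ round b p + round b′ q × 1ℚ ≤ push t b p + push t b′ q
rounding-covers-bipartite-edge true  true  b≢b′ = ⊥-elim (b≢b′ refl)
rounding-covers-bipartite-edge false false b≢b′ = ⊥-elim (b≢b′ refl)
rounding-covers-bipartite-edge true  false _ 0≤t 0≤p _   t≤mp _   1≤p+q = rounding-covers-edge 0≤t 0≤p t≤mp 1≤p+q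
rounding-covers-bipartite-edge {t} false true {p} {q} _ 0≤t _ 0≤q _ t≤mq 1≤p+q
  with rounding-covers-edge 0≤t 0≤q t≤mq (subst (1ℚ ≤_) (+-comm p q) 1≤p+q)
... | round-covers , push-covers =
  subst (1ℚ ≤_) (+-comm (round true q) (round false p)) round-covers ,
  subst (1ℚ ≤_) (+-comm (push t true q) (push t false p)) push-covers

deviation-bound-extrapolate : ∀ {t D} a c r s → 0ℚ ≤ t → 0ℚ ≤ D → a + (0ℚ - c) ≤ D →
  (r ≡ false → s ≡ true → t ≤ c - a) →
  extrapolate t (Bool→ℚ r) a + (0ℚ - extrapolate t (Bool→ℚ s) c) ≤ extrapolate t (Bool→ℚ (r ∧ not s)) D
deviation-bound-extrapolate {t} {D} a c r s 0≤t 0≤D a-c≤D gap = begin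
  extrapolate t (Bool→ℚ r) a + (0ℚ - extrapolate t (Bool→ℚ s) c)
    ≡⟨ extrapolate-difference t (Bool→ℚ r) a (Bool→ℚ s) c ⟩
  extrapolate t (Bool→ℚ r + (0ℚ - Bool→ℚ s)) (a + (0ℚ - c))
    ≤⟨ extrapolate-mono t (Bool→ℚ r + (0ℚ - Bool→ℚ s)) (a + (0ℚ - c)) (Bool→ℚ (r ∧ not s)) D
         (subst (λ z → 0ℚ ≤ extrapolate t z slack) (sym (Bool→ℚ-deviation-slack r s)) (slack-extrapolated r s gap)) ⟩
  extrapolate t (Bool→ℚ (r ∧ not s)) D ∎
  where
  open ≤-Reasoning
  slack : ℚ
  slack = D - (a + (0ℚ - c))
  c-a≤slack : c - a ≤ slack
  c-a≤slack = ≤-by-slack D (solve 3 (λ a c D → D :- (a :+ (con 0ℚ :- c)) := (c :- a) :+ D) refl a c D) 0≤D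
  0≤slack : 0ℚ ≤ slack
  0≤slack = p≤q⇒0≤q-p a-c≤D
  slack-extrapolated : ∀ r s → (r ≡ false → s ≡ true → t ≤ c - a) →
    0ℚ ≤ extrapolate t (Bool→ℚ (not r ∧ s)) slack
  slack-extrapolated false true  gap = extrapolate-nonNeg 0≤t (≤-trans (gap refl refl) c-a≤slack) ≤-refl
  slack-extrapolated false false _   = ≤-trans 0≤slack (≤-extrapolate 0≤t 0≤slack)
  slack-extrapolated true  _     _   = ≤-trans 0≤slack (≤-extrapolate 0≤t 0≤slack)

deviation-nonNeg-extrapolate : ∀ {t D} a c r s → 0ℚ ≤ t → 0ℚ ≤ D → a + (0ℚ - c) ≤ D →
  (r ≡ true → s ≡ false → t ≤ a - c) → 0ℚ ≤ extrapolate t (Bool→ℚ (r ∧ not s)) D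
deviation-nonNeg-extrapolate {t} {D} a c true false 0≤t _ a-c≤D gap =
  extrapolate-nonNeg 0≤t (≤-trans (gap refl refl)
    (subst (_≤ D) (solve 2 (λ a c → a :+ (con 0ℚ :- c) := a :- c) refl a c) a-c≤D)) ≤-refl
deviation-nonNeg-extrapolate _ _ true  true  0≤t 0≤D _ _ = ≤-trans 0≤D (≤-extrapolate 0≤t 0≤D)
deviation-nonNeg-extrapolate _ _ false _     0≤t 0≤D _ _ = ≤-trans 0≤D (≤-extrapolate 0≤t 0≤D)

-- Rounding in the core of the assignment game

record InCore {n} (W : Fin n → Bool) (Ed : List (Edge n)) (k : ℕ) (y : Fin n → ℚ) : Set where
  field
    edge   : ∀ {u v} → (u , v) ∈ Ed → 1ℚ ≤ y u + y v
    sum    : Σℚ n (λ v → if W v then y v else 0ℚ) ≡ ℕ→ℚ k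
    nonNeg : ∀ v → T (W v) → 0ℚ ≤ y v
    out    : ∀ v → ¬ T (W v) → y v ≡ 0ℚ

nonNeg-everywhere : ∀ {n} (W : Fin n → Bool) {f : Fin n → ℚ} →
  (∀ v → T (W v) → 0ℚ ≤ f v) → (∀ v → ¬ T (W v) → f v ≡ 0ℚ) → ∀ v → 0ℚ ≤ f v
nonNeg-everywhere W nonNeg out v with W v | nonNeg v | out v
... | true  | 0≤fv | _   = 0≤fv tt
... | false | _    | fv≡0 = ≤-reflexive (sym (fv≡0 (λ ())))

module CoreRounding {n} (side : Fin n → Bool) {W : Fin n → Bool} {Ed : List (Edge n)} {k : ℕ}
    (bipartite : ∀ {u v} → (u , v) ∈ Ed → side u ≢ side v) (k-max : IsMatchingNumber Ed k)
    {y : Fin n → ℚ} (y-core : InCore W Ed k y)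
    {t : ℚ} (0<t : 0ℚ < t) (t≤margin : ∀ v → t ≤ margin (side v) (y v)) where

  open InCore y-core

  z w : Fin n → ℚ
  z v = round (side v) (y v)
  w v = push t (side v) (y v)

  0≤t : 0ℚ ≤ t
  0≤t = <⇒≤ 0<t

  0≤y : ∀ v → 0ℚ ≤ y v
  0≤y = nonNeg-everywhere W nonNeg out

  0≤z : ∀ v → 0ℚ ≤ z v
  0≤z v = Bool→ℚ-nonNeg (roundsUp (side v) (y v))

  0≤w : ∀ v → 0ℚ ≤ w v
  0≤w v = push-nonNeg (side v) 0≤t (0≤y v) (t≤margin v)

  loopless : ∀ {u v} → (u , v) ∈ Ed → u ≢ v
  loopless uv∈Ed u≡v = bipartite uv∈Ed (cong side u≡v)

  covers : ∀ {u v} → (u , v) ∈ Ed → 1ℚ ≤ z u + z v × 1ℚ ≤ w u + w v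
  covers {u} {v} uv∈Ed = rounding-covers-bipartite-edge (side u) (side v) (bipartite uv∈Ed) 0≤t
    (0≤y u) (0≤y v) (t≤margin u) (t≤margin v) (edge uv∈Ed)

  z-out : ∀ v → ¬ T (W v) → z v ≡ 0ℚ
  z-out v v∉W rewrite out v v∉W | roundsUp-0 (side v) = refl

  w-out : ∀ v → ¬ T (W v) → w v ≡ 0ℚ
  w-out v v∉W rewrite out v v∉W | roundsUp-0 (side v) = extrapolate-self t 0ℚ

  Σw≡ : Σℚ n w ≡ extrapolate t (Σℚ n z) (ℕ→ℚ k)
  Σw≡ = trans (Σℚ-extrapolate t n z y (λ _ → refl))
              (cong (extrapolate t (Σℚ n z)) (trans (sym (Σℚ-restrict n W out)) sum))

  k≤Σz : ℕ→ℚ k ≤ Σℚ n z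
  k≤Σz = matchingNumber≤cover z k-max loopless 0≤z (λ uv∈Ed → proj₁ (covers uv∈Ed))

  k≤Σw : ℕ→ℚ k ≤ Σℚ n w
  k≤Σw = matchingNumber≤cover w k-max loopless 0≤w (λ uv∈Ed → proj₂ (covers uv∈Ed))

  Σz≡k : Σℚ n z ≡ ℕ→ℚ k
  Σz≡k = ≤-antisym (≤extrapolate⇒≤ 0<t (subst (ℕ→ℚ k ≤_) Σw≡ k≤Σw)) k≤Σz

  Σw≡k : Σℚ n w ≡ ℕ→ℚ k
  Σw≡k = trans Σw≡ (trans (cong (λ s → extrapolate t s (ℕ→ℚ k)) Σz≡k) (extrapolate-self t (ℕ→ℚ k)))

  rounded-inCore : InCore W Ed k z
  rounded-inCore = record
    { edge   = λ uv∈Ed → proj₁ (covers uv∈Ed)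
    ; sum    = trans (Σℚ-restrict n W z-out) Σz≡k
    ; nonNeg = λ v _ → 0≤z v
    ; out    = z-out
    }

  pushed-inCore : InCore W Ed k w
  pushed-inCore = record
    { edge   = λ uv∈Ed → proj₂ (covers uv∈Ed)
    ; sum    = trans (Σℚ-restrict n W w-out) Σw≡k
    ; nonNeg = λ v _ → 0≤w v
    ; out    = w-out
    }

module LPRounding {n m : ℕ}
    {V₀ : Fin n → Bool} {E₀ : List (Edge n)} {ν₀ : ℕ}
    {V : Fin m → Fin n → Bool} {E : Fin m → List (Edge n)} {ν : Fin m → ℕ}
    (side : Fin n → Bool)
    (bipartite₀ : ∀ {u v} → (u , v) ∈ E₀ → side u ≢ side v)
    (bipartite : ∀ S {u v} → (u , v) ∈ E S → side u ≢ side v)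
    (ν₀-max : IsMatchingNumber E₀ ν₀) (ν-max : ∀ S → IsMatchingNumber (E S) (ν S))
    {x : Point n m} (x-feasible : Feasible V₀ E₀ ν₀ V E ν x) where

  open Feasible x-feasible

  layer : Fin (suc m) → Fin n → ℚ
  layer zero    = y x
  layer (suc S) = yS x S

  margins : Fin (suc m) → Fin n → ℚ
  margins ℓ v = margin (side v) (layer ℓ v)

  t : ℚ
  t = minimum (suc m) (λ ℓ → minimum n (margins ℓ))

  0<t : 0ℚ < t
  0<t = minimum-pos (suc m) (λ ℓ → minimum n (margins ℓ))
          (λ ℓ → minimum-pos n (margins ℓ) (λ v → margin-pos (side v) (layer ℓ v)))

  0≤t : 0ℚ ≤ t
  0≤t = <⇒≤ 0<t

  t≤margin : ∀ ℓ v → t ≤ margins ℓ v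
  t≤margin ℓ v = ≤-trans (minimum-≤ (suc m) (λ ℓ → minimum n (margins ℓ)) ℓ) (minimum-≤ n (margins ℓ) v)

  core₀ : InCore V₀ E₀ ν₀ (y x)
  core₀ = record { edge = y-edge ; sum = y-sum ; nonNeg = y-nonneg ; out = y-out }

  coreS : ∀ S → InCore (V S) (E S) (ν S) (yS x S)
  coreS S = record { edge = yS-edge S ; sum = yS-sum S ; nonNeg = yS-nonneg S ; out = yS-out S }

  module R₀ = CoreRounding side bipartite₀ ν₀-max core₀ 0<t (t≤margin zero)
  module RS (S : Fin m) = CoreRounding side (bipartite S) (ν-max S) (coreS S) 0<t (t≤margin (suc S))

  up₀ : Fin n → Bool
  up₀ v = roundsUp (side v) (y x v)

  upS : Fin m → Fin n → Bool
  upS S v = roundsUp (side v) (yS x S v)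

  gap₀S : ∀ S v → up₀ v ≡ false → upS S v ≡ true → t ≤ yS x S v - y x v
  gap₀S S v = rounding-gap (side v) (t≤margin zero v) (t≤margin (suc S) v)

  gapS₀ : ∀ S v → upS S v ≡ false → up₀ v ≡ true → t ≤ y x v - yS x S v
  gapS₀ S v = rounding-gap (side v) (t≤margin (suc S) v) (t≤margin zero v)

  inside : Fin m → Fin n → Bool
  inside S v = V₀ v ∧ V S v

  δ-up d-up : Fin m → Fin n → Bool
  δ-up S v = up₀ v ∧ not (upS S v)
  d-up S v = upS S v ∧ not (up₀ v)

  -- Bool→ℚ (r ∧ not s) is the positive part of Bool→ℚ r - Bool→ℚ s.
  rounded : Point n m
  rounded = pt R₀.z RS.z (λ S v → Bool→ℚ (inside S v ∧ δ-up S v)) (λ S v → Bool→ℚ (inside S v ∧ d-up S v))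

  pushed : Point n m
  pushed = extrapolatePoint t rounded x

  rounded-integer : IsIntegerPoint rounded
  rounded-integer = (λ v → Bool→ℚ-integer (up₀ v)) , (λ S v → Bool→ℚ-integer (upS S v)) ,
                    (λ S v → Bool→ℚ-integer (inside S v ∧ δ-up S v)) , (λ S v → Bool→ℚ-integer (inside S v ∧ d-up S v))

  rounded-feasible : Feasible V₀ E₀ ν₀ V E ν rounded
  rounded-feasible = record
    { y-edge    = InCore.edge R₀.rounded-inCore
    ; y-sum     = InCore.sum R₀.rounded-inCore
    ; y-nonneg  = InCore.nonNeg R₀.rounded-inCore
    ; yS-edge   = λ S → InCore.edge (RS.rounded-inCore S)
    ; yS-sum    = λ S → InCore.sum (RS.rounded-inCore S)
    ; yS-nonneg = λ S → InCore.nonNeg (RS.rounded-inCore S)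
    ; δ-bound   = λ S v v-in → subst (R₀.z v + (0ℚ - RS.z S v) ≤_) (sym (Bool→ℚ-∧-T (δ-up S v) v-in))
                                 (Bool→ℚ-deviation (up₀ v) (upS S v))
    ; d-bound   = λ S v v-in → subst (RS.z S v + (0ℚ - R₀.z v) ≤_) (sym (Bool→ℚ-∧-T (d-up S v) v-in))
                                 (Bool→ℚ-deviation (upS S v) (up₀ v))
    ; δ-nonneg  = λ S v _ → Bool→ℚ-nonNeg (inside S v ∧ δ-up S v)
    ; d-nonneg  = λ S v _ → Bool→ℚ-nonNeg (inside S v ∧ d-up S v)
    ; y-out     = InCore.out R₀.rounded-inCore
    ; yS-out    = λ S → InCore.out (RS.rounded-inCore S)
    ; δ-out     = λ S v v-out → Bool→ℚ-∧-¬T (δ-up S v) v-out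
    ; d-out     = λ S v v-out → Bool→ℚ-∧-¬T (d-up S v) v-out
    }

  pushed-feasible : Feasible V₀ E₀ ν₀ V E ν pushed
  pushed-feasible = record
    { y-edge    = InCore.edge R₀.pushed-inCore
    ; y-sum     = InCore.sum R₀.pushed-inCore
    ; y-nonneg  = InCore.nonNeg R₀.pushed-inCore
    ; yS-edge   = λ S → InCore.edge (RS.pushed-inCore S)
    ; yS-sum    = λ S → InCore.sum (RS.pushed-inCore S)
    ; yS-nonneg = λ S → InCore.nonNeg (RS.pushed-inCore S)
    ; δ-bound   = λ S v v-in → on-inside (δ-up S v) v-in (δ x S v) (R₀.w v + (0ℚ - RS.w S v) ≤_)
        (deviation-bound-extrapolate (y x v) (yS x S v) (up₀ v) (upS S v) 0≤t (δ-nonneg S v v-in) (δ-bound S v v-in)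
          (gap₀S S v))
    ; d-bound   = λ S v v-in → on-inside (d-up S v) v-in (d x S v) (RS.w S v + (0ℚ - R₀.w v) ≤_)
        (deviation-bound-extrapolate (yS x S v) (y x v) (upS S v) (up₀ v) 0≤t (d-nonneg S v v-in) (d-bound S v v-in)
          (gapS₀ S v))
    ; δ-nonneg  = λ S v v-in → on-inside (δ-up S v) v-in (δ x S v) (0ℚ ≤_)
        (deviation-nonNeg-extrapolate (y x v) (yS x S v) (up₀ v) (upS S v) 0≤t (δ-nonneg S v v-in) (δ-bound S v v-in)
          (λ up down → gapS₀ S v down up))
    ; d-nonneg  = λ S v v-in → on-inside (d-up S v) v-in (d x S v) (0ℚ ≤_)
        (deviation-nonNeg-extrapolate (yS x S v) (y x v) (upS S v) (up₀ v) 0≤t (d-nonneg S v v-in) (d-bound S v v-in)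
          (λ up down → gap₀S S v down up))
    ; y-out     = InCore.out R₀.pushed-inCore
    ; yS-out    = λ S → InCore.out (RS.pushed-inCore S)
    ; δ-out     = λ S v v-out → on-outside (δ-up S v) v-out (δ-out S v v-out)
    ; d-out     = λ S v v-out → on-outside (d-up S v) v-out (d-out S v v-out)
    }
    where
    on-inside : ∀ {b} r → T b → ∀ D (P : ℚ → Set) →
      P (extrapolate t (Bool→ℚ r) D) → P (extrapolate t (Bool→ℚ (b ∧ r)) D)
    on-inside r b-true D P = subst (λ z → P (extrapolate t z D)) (sym (Bool→ℚ-∧-T r b-true))
    on-outside : ∀ {b} r {D} → ¬ T b → D ≡ 0ℚ → extrapolate t (Bool→ℚ (b ∧ r)) D ≡ 0ℚ
    on-outside r b-false D≡0 = trans (cong₂ (extrapolate t) (Bool→ℚ-∧-¬T r b-false) D≡0) (extrapolate-self t 0ℚ)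

-- The objective (p, λ) does not enter the feasible region, and the argument never needs the
-- edges to lie inside V₀ or V_S.
theorem1 : ∀ {n m : ℕ}
    (V₀ : Fin n → Bool) (E₀ : List (Edge n)) (ν₀ : ℕ)
    (V : Fin m → Fin n → Bool) (E : Fin m → List (Edge n)) (ν : Fin m → ℕ)
    (p : Fin m → ℚ) (λw : Fin n → ℚ) →
    (∀ S → 0ℚ ≤ p S) →
    (∀ v → 0ℚ ≤ λw v) →
    (∀ {u v} → (u , v) ∈ E₀ → T (V₀ u) × T (V₀ v)) →
    (∀ S {u v} → (u , v) ∈ E S → T (V S u) × T (V S v)) →
    (side : Fin n → Bool) →
    (∀ {u v} → (u , v) ∈ E₀ → side u ≢ side v) →
    (∀ S {u v} → (u , v) ∈ E S → side u ≢ side v) →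
    IsMatchingNumber E₀ ν₀ →
    (∀ S → IsMatchingNumber (E S) (ν S)) →
    IsIntegralPolyhedron (Feasible V₀ E₀ ν₀ V E ν)
theorem1 V₀ E₀ ν₀ V E ν _ _ _ _ _ _ side bipartite₀ bipartite ν₀-max ν-max =
  integral-by-extrapolation λ x x-feasible →
    let open LPRounding side bipartite₀ bipartite ν₀-max ν-max x-feasible
    in rounded , rounded-feasible , rounded-integer , t , 0<t , pushed-feasible
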